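{- Let $\mathfrak A$ be a relational structure with domain $\mathbb Q$ and finite relational signature $\tau$ all of whose relations are first-order definable over $\mathfrak L$, and let $\mathfrak A^\star$ be the associated $\tau$-structure on $\mathbb Q^\star$ (as defined in the context). Then a $\tau$-formula $\phi$ is satisfiable in $\mathfrak A$ if and only if $\phi$ is satisfiable in $\mathfrak A^\star$.
   Context: $\mathfrak L=(\mathbb Q;<,1,(c\cdot)_{c\in\mathbb Q})$ with signature $\tau_0=\{<,1\}\cup\{c\cdot\}_{c\in\mathbb Q}$: $<$ is the strict order, $1$ the constant $1$, $c\cdot$ the map $x\mapsto cx$. Since $\mathfrak L$ has quantifier elimination, for each $R\in\tau$ fix a quantifier-free $\tau_0$-formula $\phi_R$ defining $R^{\mathfrak A}$ over $\mathfrak L$. $\mathbb Q^\star=\{x+y\boldsymbol\epsilon: x,y\in\mathbb Q\}$ is the ordered $\mathbb Q$-vector space of formal pairs $(x,y)$ written $x+y\boldsymbol\epsilon$, with componentwise addition and scalar multiplication, with $\mathbb Q$ embedded via $x\mapsto x+0\boldsymbol\epsilon$, and with the lexicographic order: $x_1+y_1\boldsymbol\epsilon<x_2+y_2\boldsymbol\epsilon$ iff $x_1<x_2$, or $x_1=x_2$ and $y_1<y_2$. $\tau_0$-formulas are interpreted in $\mathbb Q^\star$ in the obvious way ($<$ as this order, $1$ as $1+0\boldsymbol\epsilon$, $c\cdot$ as scalar multiplication). $\mathfrak A^\star$ is the $\tau$-structure with domain $\mathbb Q^\star$ in which each $R\in\tau$ is interpreted as the relation defined over $\mathbb Q^\star$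 by $\phi_R$ (the choice of equivalent defining formula is immaterial). -}

module Defs where

open import Data.Nat using (ℕ)
open import Data.Fin using (Fin)
open import Data.Rational as Q using (ℚ)
open import Data.Product using (Σ; _×_; _,_)
open import Data.Sum using (_⊎_)
open import Data.Empty using (⊥)
open import Data.Unit using (⊤)
open import Relation.Nullary using (¬_; yes; no)
open import Relation.Binary.PropositionalEquality using (_≡_)
open import Function.Bundles using (_⇔_)

data Term₀ (V : Set) : Set where
  var  : V → Term₀ V
  one  : Term₀ V
  smul : ℚ → Term₀ V → Term₀ V

data QF₀ (V : Set) : Set where
  tt ff     : QF₀ V
  _≐₀_ _⋖₀_ : Term₀ V → Term₀ V → QF₀ V
  ¬₀_       : QF₀ V → QF₀ V
  _∧₀_ _∨₀_ : QF₀ V → QF₀ V → QF₀ V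

record τ₀-Structure : Set₁ where
  field
    Carrier : Set
    _<_     : Carrier → Carrier → Set
    𝟙       : Carrier
    _·_     : ℚ → Carrier → Carrier

module _ (M : τ₀-Structure) where
  open τ₀-Structure M

  evalT : {V : Set} → (V → Carrier) → Term₀ V → Carrier
  evalT s (var v)    = s v
  evalT s one        = 𝟙
  evalT s (smul c t) = c · evalT s t

  evalQF : {V : Set} → (V → Carrier) → QF₀ V → Set
  evalQF s tt        = ⊤
  evalQF s ff        = ⊥
  evalQF s (t ≐₀ u)  = evalT s t ≡ evalT s u
  evalQF s (t ⋖₀ u)  = evalT s t < evalT s u
  evalQF s (¬₀ φ)    = ¬ evalQF s φ
  evalQF s (φ ∧₀ ψ)  = evalQF s φ × evalQF s ψ
  evalQF s (φ ∨₀ ψ)  = evalQF s φ ⊎ evalQF s ψ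

𝔏 : τ₀-Structure
𝔏 = record { Carrier = ℚ ; _<_ = Q._<_ ; 𝟙 = Q.1ℚ ; _·_ = Q._*_ }

record ℚ⋆ : Set where
  constructor _+_ε
  field
    re  : ℚ
    eps : ℚ
open ℚ⋆ public

_<⋆_ : ℚ⋆ → ℚ⋆ → Set
a <⋆ b = (re a Q.< re b) ⊎ ((re a ≡ re b) × (eps a Q.< eps b))

_·⋆_ : ℚ → ℚ⋆ → ℚ⋆
c ·⋆ a = (c Q.* re a) + (c Q.* eps a) ε

ι : ℚ → ℚ⋆
ι x = x + Q.0ℚ ε

𝔏⋆ : τ₀-Structure
𝔏⋆ = record { Carrier = ℚ⋆ ; _<_ = _<⋆_ ; 𝟙 = ι Q.1ℚ ; _·_ = _·⋆_ }

record Signature : Set where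
  field
    size  : ℕ
    arity : Fin size → ℕ
open Signature public

record Structure (σ : Signature) (D : Set) : Set₁ where
  field
    rel : (i : Fin (size σ)) → (Fin (arity σ i) → D) → Set
open Structure public

data Formula (σ : Signature) : Set where
  R     : (i : Fin (size σ)) → (Fin (arity σ i) → ℕ) → Formula σ
  _≐_   : ℕ → ℕ → Formula σ
  ⊥'    : Formula σ
  ¬'_   : Formula σ → Formula σ
  _∧'_  : Formula σ → Formula σ → Formula σ
  _∨'_  : Formula σ → Formula σ → Formula σ
  ∃'    : ℕ → Formula σ → Formula σ
  ∀'    : ℕ → Formula σ → Formula σ

update : {D : Set} → (ℕ → D) → ℕ → D → ℕ → D
update s x d y with x Data.Nat.≟ y
... | yes _ = d
... | no  _ = s y

Sat : {σ : Signature} {D : Set} → Structure σ D → (ℕ → D) → Formula σ → Set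
Sat 𝔄 s (R i xs)   = rel 𝔄 i (λ j → s (xs j))
Sat 𝔄 s (x ≐ y)    = s x ≡ s y
Sat 𝔄 s ⊥'         = ⊥
Sat 𝔄 s (¬' φ)     = ¬ Sat 𝔄 s φ
Sat 𝔄 s (φ ∧' ψ)   = Sat 𝔄 s φ × Sat 𝔄 s ψ
Sat 𝔄 s (φ ∨' ψ)   = Sat 𝔄 s φ ⊎ Sat 𝔄 s ψ
Sat {D = D} 𝔄 s (∃' x φ) = Σ D λ d → Sat 𝔄 (update s x d) φ
Sat {D = D} 𝔄 s (∀' x φ) = (d : D) → Sat 𝔄 (update s x d) φ

Satisfiable : {σ : Signature} {D : Set} → Structure σ D → Formula σ → Set
Satisfiable {D = D} 𝔄 φ = Σ (ℕ → D) λ s → Sat 𝔄 s φ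

QFDefs : Signature → Set
QFDefs σ = (i : Fin (size σ)) → QF₀ (Fin (arity σ i))

Defines : {σ : Signature} → Structure σ ℚ → QFDefs σ → Set
Defines {σ} 𝔄 φs = (i : Fin (size σ)) (x : Fin (arity σ i) → ℚ) →
  rel 𝔄 i x ⇔ evalQF 𝔏 x (φs i)

Star : {σ : Signature} → QFDefs σ → Structure σ ℚ⋆
Star φs = record { rel = λ i x → evalQF 𝔏⋆ x (φs i) }

module Submission where

-- Both 𝔏 and 𝔏⋆ are ordered ℚ-vector spaces with 𝟙 > 0, and 𝔄, 𝔄⋆ are defined over them by the
-- same quantifier-free formulas. There every τ₀-term equals c · u with c rational and u a variable
-- or 𝟙, so a quantifier-free formula only sees how finitely many points c · u are ordered. Say that
-- assignments s, t agree for a finite set T of coefficients if the points c · s v and c · t v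
-- (c ∈ T, v a variable or 𝟙) are ordered alike. If they agree for T, 0 and all ratios k / c of
-- elements of T, then any new value d of s is matched by some e for t keeping agreement for T:
-- since c · d compares with k · u as d does with (k / c) · u, it suffices to put e into the cut
-- over the points (k / c) · t v that d occupies over the (k / c) · s v, which density and the
-- absence of endpoints allow. Closing T under ratios once per quantifier thus yields a
-- back-and-forth system, so agreeing assignments satisfy the same formulas, and an agreeing
-- assignment into either structure can be built from any assignment into the other.

open import Defs
open import Data.Fin using (Fin)
open import Data.List using (List; []; _∷_; map; _++_; concat; allFin; cartesianProduct; cartesianProductWith)
open import Data.List.Membership.Propositional using (_∈_; find)
open import Data.List.Membership.Propositional.Properties
  using (∈-map⁺; ∈-map⁻; ∈-++⁺ˡ; ∈-++⁺ʳ; ∈-allFin; ∈-concat⁺′; ∈-cartesianProduct⁺; ∈-cartesianProduct⁻; ∈-cartesianProductWith⁺)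
open import Data.List.Relation.Binary.Subset.Propositional using (_⊆_)
open import Data.List.Relation.Unary.Any as Any using (Any; here; there; any?)
open import Data.Maybe as Maybe using (Maybe; just; nothing; maybe′)
open import Data.Nat as ℕ using (ℕ; zero; suc; _≤_; _⊔_; s≤s)
open import Data.Nat.Properties using (m⊔n≤o⇒m≤o; m⊔n≤o⇒n≤o; ≤-refl)
open import Data.Product using (∃-syntax; _×_; _,_)
open import Data.Product.Function.NonDependent.Propositional using (_×-⇔_)
open import Data.Rational as Q using (ℚ; 0ℚ; 1ℚ; _*_)
import Data.Rational.Properties as QP
open import Data.Sum using (_⊎_; inj₁; inj₂)
open import Data.Sum.Function.Propositional using (_⊎-⇔_)
open import Function.Base using (_∘_; id; flip)
open import Function.Bundles using (_⇔_; mk⇔; Equivalence)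
open import Function.Construct.Composition using (_⇔-∘_)
open import Function.Construct.Identity using (⇔-id)
open import Function.Related.TypeIsomorphisms using (¬-cong-⇔)
open import Level using (0ℓ)
open import Relation.Binary.Core using (Rel)
import Relation.Binary.Construct.Flip.EqAndOrd as Flip
open import Relation.Binary.Definitions using (Tri; Trichotomous; Transitive; Dense; tri<; tri≈; tri>)
open import Relation.Binary.PropositionalEquality
open import Relation.Binary.Structures using (IsStrictTotalOrder; IsDenseLinearOrder)
open import Relation.Nullary using (¬_; yes; no; contradiction)
open import Relation.Unary using (Decidable)

data Ordering : Set where
  lt eq gt : Ordering

opposite : Ordering → Ordering
opposite lt = gt
opposite eq = eq
opposite gt = lt

infixr 7 _⊗_

-- the product of signs, reading lt, eq, gt as −1, 0, 1
_⊗_ : Ordering → Ordering → Ordering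
lt ⊗ o = opposite o
eq ⊗ o = eq
gt ⊗ o = o

module Compare {A : Set} {_<_ : Rel A 0ℓ} (O : IsStrictTotalOrder _≡_ _<_) where
  open IsStrictTotalOrder O using (compare) renaming (trans to <-trans)

  cmp : A → A → Ordering
  cmp a b with compare a b
  ... | tri< _ _ _ = lt
  ... | tri≈ _ _ _ = eq
  ... | tri> _ _ _ = gt

  module _ {a b : A} where
    cmp-< : a < b → cmp a b ≡ lt
    cmp-< a<b with compare a b
    ... | tri< _ _ _ = refl
    ... | tri≈ a≮b _ _ = contradiction a<b a≮b
    ... | tri> a≮b _ _ = contradiction a<b a≮b

    cmp-≡ : a ≡ b → cmp a b ≡ eq
    cmp-≡ a≡b with compare a b
    ... | tri< _ a≢b _ = contradiction a≡b a≢b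
    ... | tri≈ _ _ _ = refl
    ... | tri> _ a≢b _ = contradiction a≡b a≢b

    cmp-> : b < a → cmp a b ≡ gt
    cmp-> b<a with compare a b
    ... | tri< _ _ b≮a = contradiction b<a b≮a
    ... | tri≈ _ _ b≮a = contradiction b<a b≮a
    ... | tri> _ _ _ = refl

    cmp≡lt⇒< : cmp a b ≡ lt → a < b
    cmp≡lt⇒< _ with compare a b
    cmp≡lt⇒< _  | tri< a<b _ _ = a<b
    cmp≡lt⇒< () | tri≈ _ _ _
    cmp≡lt⇒< () | tri> _ _ _

    cmp≡eq⇒≡ : cmp a b ≡ eq → a ≡ b
    cmp≡eq⇒≡ _ with compare a b
    cmp≡eq⇒≡ () | tri< _ _ _
    cmp≡eq⇒≡ _  | tri≈ _ a≡b _ = a≡b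
    cmp≡eq⇒≡ () | tri> _ _ _

  cmp-sym : ∀ a b → cmp b a ≡ opposite (cmp a b)
  cmp-sym a b with compare a b
  ... | tri< a<b _ _ = cmp-> a<b
  ... | tri≈ _ a≡b _ = cmp-≡ (sym a≡b)
  ... | tri> _ _ b<a = cmp-< b<a

  ≮-<-trans : ∀ {a b c} → ¬ b < a → b < c → a < c
  ≮-<-trans {a} {b} b≮a b<c with compare a b
  ... | tri< a<b _ _ = <-trans a<b b<c
  ... | tri≈ _ refl _ = b<c
  ... | tri> _ _ b<a = contradiction b<a b≮a

module Compare₂ {A B : Set} {_<₁_ : Rel A 0ℓ} {_<₂_ : Rel B 0ℓ}
  (O₁ : IsStrictTotalOrder _≡_ _<₁_) (O₂ : IsStrictTotalOrder _≡_ _<₂_) where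
  open Compare O₁ using () renaming (cmp to cmp₁)
  open Compare O₂ using () renaming (cmp to cmp₂)
  private
    module C₁ = Compare O₁
    module C₂ = Compare O₂
    module O₁ = IsStrictTotalOrder O₁

  cmp-≡⇒<⇔ : ∀ {a b a′ b′} → cmp₁ a b ≡ cmp₂ a′ b′ → a <₁ b ⇔ a′ <₂ b′
  cmp-≡⇒<⇔ e = mk⇔ (λ a<b → C₂.cmp≡lt⇒< (trans (sym e) (C₁.cmp-< a<b)))
                   (λ a′<b′ → C₁.cmp≡lt⇒< (trans e (C₂.cmp-< a′<b′)))

  cmp-≡⇒≡⇔ : ∀ {a b a′ b′} → cmp₁ a b ≡ cmp₂ a′ b′ → a ≡ b ⇔ a′ ≡ b′
  cmp-≡⇒≡⇔ e = mk⇔ (λ a≡b → C₂.cmp≡eq⇒≡ (trans (sym e) (C₁.cmp-≡ a≡b)))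
                   (λ a′≡b′ → C₁.cmp≡eq⇒≡ (trans e (C₂.cmp-≡ a′≡b′)))

  cmp-mono : (f : A → B) → (∀ {a b} → a <₁ b → f a <₂ f b) → ∀ a b → cmp₂ (f a) (f b) ≡ cmp₁ a b
  cmp-mono f mono a b with O₁.compare a b
  ... | tri< a<b _ _ = C₂.cmp-< (mono a<b)
  ... | tri≈ _ refl _ = C₂.cmp-≡ refl
  ... | tri> _ _ b<a = C₂.cmp-> (mono b<a)

  cmp-anti : (f : A → B) → (∀ {a b} → a <₁ b → f b <₂ f a) → ∀ a b → cmp₂ (f a) (f b) ≡ opposite (cmp₁ a b)
  cmp-anti f anti a b with O₁.compare a b
  ... | tri< a<b _ _ = C₂.cmp-> (anti a<b)
  ... | tri≈ _ refl _ = C₂.cmp-≡ refl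
  ... | tri> _ _ b<a = C₂.cmp-< (anti b<a)

  SameOrder : {I : Set} → (I → A) → (I → B) → List I → Set
  SameOrder f g Is = ∀ {i j} → i ∈ Is → j ∈ Is → cmp₁ (f i) (f j) ≡ cmp₂ (g i) (g j)

  SameOrder-⊆ : ∀ {I} {f : I → A} {g : I → B} {Is Js} → Is ⊆ Js → SameOrder f g Js → SameOrder f g Is
  SameOrder-⊆ Is⊆Js same i∈ j∈ = same (Is⊆Js i∈) (Is⊆Js j∈)

-- Filling cuts in unbounded dense linear orders

record IsGreatest {I A : Set} (_<_ : Rel A 0ℓ) (f : I → A) (P : I → Set) (Is : List I) (l : I) : Set where
  constructor greatestBy
  field
    member  : l ∈ Is
    holds   : P l
    maximal : ∀ {i} → i ∈ Is → P i → ¬ f l < f i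

module Greatest {I A : Set} {_<_ : Rel A 0ℓ} (O : IsStrictTotalOrder _≡_ _<_)
                (f : I → A) {P : I → Set} (P? : Decidable P) where
  open IsStrictTotalOrder O using (compare; irrefl) renaming (trans to <-trans)

  greatest : ∀ Is → (∀ {i} → i ∈ Is → ¬ P i) ⊎ ∃[ l ] IsGreatest _<_ f P Is l
  greatest [] = inj₁ λ ()
  greatest (x ∷ Is) with P? x | greatest Is
  ... | no ¬Px | inj₁ none = inj₁ λ { (here refl) → ¬Px ; (there i∈) → none i∈ }
  ... | no ¬Px | inj₂ (l , greatestBy l∈ Pl max) =
    inj₂ (l , greatestBy (there l∈) Pl λ { (here refl) Px → contradiction Px ¬Px ; (there i∈) → max i∈ })
  ... | yes Px | inj₁ none =
    inj₂ (x , greatestBy (here refl) Px λ { (here refl) _ → irrefl refl ; (there i∈) Pi → contradiction Pi (none i∈) })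
  ... | yes Px | inj₂ (l , greatestBy l∈ Pl max) with compare (f l) (f x)
  ...   | tri< l<x _ _ = inj₂ (x , greatestBy (here refl) Px λ
          { (here refl) _ → irrefl refl
          ; (there i∈) Pi x<i → max i∈ Pi (<-trans l<x x<i) })
  ...   | tri≈ l≮x _ _ = inj₂ (l , greatestBy (there l∈) Pl λ { (here refl) _ → l≮x ; (there i∈) → max i∈ })
  ...   | tri> l≮x _ _ = inj₂ (l , greatestBy (there l∈) Pl λ { (here refl) _ → l≮x ; (there i∈) → max i∈ })

below-greatest : ∀ {I A B} {_<₁_ : Rel A 0ℓ} {_<₂_ : Rel B 0ℓ} → IsStrictTotalOrder _≡_ _<₂_ →
                 ∀ {f : I → A} {g : I → B} {P Is} →
                 (∀ {i j} → i ∈ Is → j ∈ Is → g i <₂ g j → f i <₁ f j) →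
                 ∀ {l b} → IsGreatest _<₁_ f P Is l → g l <₂ b → ∀ {i} → i ∈ Is → P i → g i <₂ b
below-greatest O₂ reflect (greatestBy l∈ _ max) gl<b i∈ Pi =
  Compare.≮-<-trans O₂ (λ gl<gi → max i∈ Pi (reflect l∈ i∈ gl<gi)) gl<b

record IsUnboundedDenseLinearOrder {A : Set} (_<_ : Rel A 0ℓ) : Set where
  field
    isDenseLinearOrder : IsDenseLinearOrder _≡_ _<_
    unboundedˡ         : ∀ a → ∃[ b ] b < a
    unboundedʳ         : ∀ a → ∃[ b ] a < b
  open IsDenseLinearOrder isDenseLinearOrder public

module _ {A B : Set} {_<₁_ : Rel A 0ℓ} {_<₂_ : Rel B 0ℓ}
  (O₁ : IsStrictTotalOrder _≡_ _<₁_) (D₂ : IsUnboundedDenseLinearOrder _<₂_) where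
  private
    module D₂ = IsUnboundedDenseLinearOrder D₂
    module O₁ = IsStrictTotalOrder O₁
    O₂ = D₂.isStrictTotalOrder
  open Compare O₁ using () renaming (cmp to cmp₁)
  open Compare O₂ using () renaming (cmp to cmp₂)
  open Compare₂ O₁ O₂
  private
    module C₁ = Compare O₁
    module C₂ = Compare O₂

  -- b is taken between the images of the greatest f i below a and of the least f i above it
  fill-cut : B → ∀ {I} {f : I → A} {g : I → B} {Is} → SameOrder f g Is →
             ∀ a → ∃[ b ] ∀ {i} → i ∈ Is → cmp₂ b (g i) ≡ cmp₁ a (f i)
  fill-cut b₀ {f = f} {g} {Is} same a with any? (λ i → a O₁.≟ f i) Is
  ... | yes hit = let i , i∈ , a≡fi = find hit in
    g i , λ j∈ → trans (sym (same i∈ j∈)) (cong (λ x → cmp₁ x (f _)) (sym a≡fi))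
  ... | no miss = let b , lower , upper = between (G.greatest Is) (Gᶠ.greatest Is) in
    b , λ {i} i∈ → placed lower upper i∈ (λ a≡fi → miss (lose i∈ a≡fi))
    where
    module G  = Greatest O₁ f (λ i → f i O₁.<? a)
    module Gᶠ = Greatest (Flip.isStrictTotalOrder O₁) f (λ i → a O₁.<? f i)

    reflect : ∀ {i j} → i ∈ Is → j ∈ Is → g i <₂ g j → f i <₁ f j
    reflect i∈ j∈ = Equivalence.from (cmp-≡⇒<⇔ (same i∈ j∈))

    preserve : ∀ {i j} → i ∈ Is → j ∈ Is → f i <₁ f j → g i <₂ g j
    preserve i∈ j∈ = Equivalence.to (cmp-≡⇒<⇔ (same i∈ j∈))

    Below Above : B → Set
    Below b = ∀ {i} → i ∈ Is → f i <₁ a → g i <₂ b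
    Above b = ∀ {i} → i ∈ Is → a <₁ f i → b <₂ g i

    between : (∀ {i} → i ∈ Is → ¬ f i <₁ a) ⊎ ∃[ l ] IsGreatest _<₁_ f (λ i → f i <₁ a) Is l →
              (∀ {i} → i ∈ Is → ¬ a <₁ f i) ⊎ ∃[ h ] IsGreatest (flip _<₁_) f (λ i → a <₁ f i) Is h →
              ∃[ b ] Below b × Above b
    between (inj₁ none<) (inj₁ none>) =
      b₀ , (λ i∈ fi<a → contradiction fi<a (none< i∈)) , (λ i∈ a<fi → contradiction a<fi (none> i∈))
    between (inj₂ (l , L)) (inj₁ none>) = let b , gl<b = D₂.unboundedʳ (g l) in
      b , below-greatest O₂ reflect L gl<b , (λ i∈ a<fi → contradiction a<fi (none> i∈))
    between (inj₁ none<) (inj₂ (h , H)) = let b , b<gh = D₂.unboundedˡ (g h) in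
      b , (λ i∈ fi<a → contradiction fi<a (none< i∈))
        , below-greatest (Flip.isStrictTotalOrder O₂) (λ i∈ j∈ → reflect j∈ i∈) H b<gh
    between (inj₂ (l , L@(greatestBy l∈ fl<a _))) (inj₂ (h , H@(greatestBy h∈ a<fh _))) =
      let b , gl<b , b<gh = D₂.dense (preserve l∈ h∈ (O₁.trans fl<a a<fh)) in
      b , below-greatest O₂ reflect L gl<b
        , below-greatest (Flip.isStrictTotalOrder O₂) (λ i∈ j∈ → reflect j∈ i∈) H b<gh

    lose : ∀ {i} → i ∈ Is → a ≡ f i → Any (λ j → a ≡ f j) Is
    lose i∈ a≡fi = Any.map (λ { refl → a≡fi }) i∈

    placed : ∀ {b} → Below b → Above b → ∀ {i} → i ∈ Is → a ≢ f i → cmp₂ b (g i) ≡ cmp₁ a (f i)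
    placed lower upper {i} i∈ a≢fi with O₁.compare a (f i)
    ... | tri< a<fi _ _ = C₂.cmp-< (upper i∈ a<fi)
    ... | tri≈ _ a≡fi _ = contradiction a≡fi a≢fi
    ... | tri> _ _ fi<a = C₂.cmp-> (lower i∈ fi<a)

-- What the argument uses of an ordered ℚ-vector space with 𝟙 > 0, stated in τ₀ (0ℚ · 𝟙 is its zero)
record IsOrderedℚSpace (M : τ₀-Structure) : Set where
  open τ₀-Structure M
  field
    isUnboundedDenseLinearOrder : IsUnboundedDenseLinearOrder _<_
    ·-assoc       : ∀ c d a → (c · (d · a)) ≡ ((c * d) · a)
    ·-identityˡ   : ∀ a → (1ℚ · a) ≡ a
    ·-zeroˡ       : ∀ a → (0ℚ · a) ≡ (0ℚ · 𝟙)
    ·-monoʳ-<-pos : ∀ {c a b} → 0ℚ Q.< c → a < b → (c · a) < (c · b)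
    ·-monoʳ-<-neg : ∀ {c a b} → c Q.< 0ℚ → a < b → (c · b) < (c · a)
    ·-monoˡ-<-pos : ∀ {c d a} → (0ℚ · 𝟙) < a → c Q.< d → (c · a) < (d · a)
    ·-monoˡ-<-neg : ∀ {c d a} → a < (0ℚ · 𝟙) → c Q.< d → (d · a) < (c · a)
    0<𝟙           : (0ℚ · 𝟙) < 𝟙
  open IsUnboundedDenseLinearOrder isUnboundedDenseLinearOrder public

p-1<p : ∀ p → p Q.- 1ℚ Q.< p
p-1<p p = subst (p Q.- 1ℚ Q.<_) (QP.+-identityʳ p) (QP.+-mono-≤-< (QP.≤-refl {p}) (QP.negative⁻¹ (Q.- 1ℚ)))

p<p+1 : ∀ p → p Q.< p Q.+ 1ℚ
p<p+1 p = subst (Q._< p Q.+ 1ℚ) (QP.+-identityʳ p) (QP.+-mono-≤-< (QP.≤-refl {p}) (QP.positive⁻¹ 1ℚ))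

𝔏-isOrderedℚSpace : IsOrderedℚSpace 𝔏
𝔏-isOrderedℚSpace = record
  { isUnboundedDenseLinearOrder = record
    { isDenseLinearOrder = QP.<-isDenseLinearOrder
    ; unboundedˡ = λ p → p Q.- 1ℚ , p-1<p p
    ; unboundedʳ = λ p → p Q.+ 1ℚ , p<p+1 p
    }
  ; ·-assoc       = λ c d a → sym (QP.*-assoc c d a)
  ; ·-identityˡ   = QP.*-identityˡ
  ; ·-zeroˡ       = QP.*-zeroˡ
  ; ·-monoʳ-<-pos = λ {c} 0<c → QP.*-monoʳ-<-pos c {{Q.positive 0<c}}
  ; ·-monoʳ-<-neg = λ {c} c<0 → QP.*-monoʳ-<-neg c {{Q.negative c<0}}
  ; ·-monoˡ-<-pos = λ {_} {_} {a} 0<a → QP.*-monoˡ-<-pos a {{Q.positive 0<a}}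
  ; ·-monoˡ-<-neg = λ {_} {_} {a} a<0 → QP.*-monoˡ-<-neg a {{Q.negative a<0}}
  ; 0<𝟙           = QP.positive⁻¹ 1ℚ
  }

<⋆-irrefl : ∀ {a b} → a ≡ b → ¬ a <⋆ b
<⋆-irrefl refl (inj₁ r<r)       = QP.<-irrefl refl r<r
<⋆-irrefl refl (inj₂ (_ , e<e)) = QP.<-irrefl refl e<e

<⋆-trans : Transitive _<⋆_
<⋆-trans (inj₁ p) (inj₁ q)             = inj₁ (QP.<-trans p q)
<⋆-trans (inj₁ p) (inj₂ (refl , _))    = inj₁ p
<⋆-trans (inj₂ (refl , _)) (inj₁ q)    = inj₁ q
<⋆-trans (inj₂ (refl , p)) (inj₂ (e , q)) = inj₂ (e , QP.<-trans p q)

tri-<⋆ : ∀ {a b} → a <⋆ b → Tri (a <⋆ b) (a ≡ b) (b <⋆ a)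
tri-<⋆ a<b = tri< a<b (λ a≡b → <⋆-irrefl a≡b a<b) (λ b<a → <⋆-irrefl refl (<⋆-trans a<b b<a))

tri->⋆ : ∀ {a b} → b <⋆ a → Tri (a <⋆ b) (a ≡ b) (b <⋆ a)
tri->⋆ b<a = tri> (λ a<b → <⋆-irrefl refl (<⋆-trans b<a a<b)) (λ a≡b → <⋆-irrefl (sym a≡b) b<a) b<a

<⋆-cmp : Trichotomous _≡_ _<⋆_
<⋆-cmp (x + y ε) (u + v ε) with QP.<-cmp x u
... | tri< x<u _ _ = tri-<⋆ (inj₁ x<u)
... | tri> _ _ u<x = tri->⋆ (inj₁ u<x)
... | tri≈ _ refl _ with QP.<-cmp y v
...   | tri< y<v _ _  = tri-<⋆ (inj₂ (refl , y<v))
...   | tri≈ _ refl _ = tri≈ (<⋆-irrefl refl) refl (<⋆-irrefl refl)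
...   | tri> _ _ v<y  = tri->⋆ (inj₂ (refl , v<y))

<⋆-dense : Dense _<⋆_
<⋆-dense (inj₁ x<u) = let m , x<m , m<u = QP.<-dense x<u in ι m , inj₁ x<m , inj₁ m<u
<⋆-dense {x + _ ε} (inj₂ (x≡u , y<v)) = let m , y<m , m<v = QP.<-dense y<v in
  x + m ε , inj₂ (refl , y<m) , inj₂ (x≡u , m<v)

<⋆-isDenseLinearOrder : IsDenseLinearOrder _≡_ _<⋆_
<⋆-isDenseLinearOrder = record
  { isStrictTotalOrder = record
    { isStrictPartialOrder = record
      { isEquivalence = isEquivalence
      ; irrefl = <⋆-irrefl
      ; trans = <⋆-trans
      ; <-resp-≈ = resp₂ _<⋆_
      }
    ; compare = <⋆-cmp
    }
  ; dense = <⋆-dense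
  }

𝔏⋆-isOrderedℚSpace : IsOrderedℚSpace 𝔏⋆
𝔏⋆-isOrderedℚSpace = record
  { isUnboundedDenseLinearOrder = record
    { isDenseLinearOrder = <⋆-isDenseLinearOrder
    ; unboundedˡ = λ (x + y ε) → (x Q.- 1ℚ) + y ε , inj₁ (p-1<p x)
    ; unboundedʳ = λ (x + y ε) → (x Q.+ 1ℚ) + y ε , inj₁ (p<p+1 x)
    }
  ; ·-assoc       = λ c d (x + y ε) → cong₂ _+_ε (sym (QP.*-assoc c d x)) (sym (QP.*-assoc c d y))
  ; ·-identityˡ   = λ (x + y ε) → cong₂ _+_ε (QP.*-identityˡ x) (QP.*-identityˡ y)
  ; ·-zeroˡ       = λ (x + y ε) → cong₂ _+_ε (QP.*-zeroˡ x) (QP.*-zeroˡ y)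
  ; ·-monoʳ-<-pos = monoʳ-pos
  ; ·-monoʳ-<-neg = monoʳ-neg
  ; ·-monoˡ-<-pos = monoˡ-pos
  ; ·-monoˡ-<-neg = monoˡ-neg
  ; 0<𝟙           = inj₁ (QP.positive⁻¹ 1ℚ)
  }
  where
  monoʳ-pos : ∀ {c a b} → 0ℚ Q.< c → a <⋆ b → (c ·⋆ a) <⋆ (c ·⋆ b)
  monoʳ-pos {c} 0<c (inj₁ p)       = inj₁ (QP.*-monoʳ-<-pos c {{Q.positive 0<c}} p)
  monoʳ-pos {c} 0<c (inj₂ (e , p)) = inj₂ (cong (c *_) e , QP.*-monoʳ-<-pos c {{Q.positive 0<c}} p)
  monoʳ-neg : ∀ {c a b} → c Q.< 0ℚ → a <⋆ b → (c ·⋆ b) <⋆ (c ·⋆ a)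
  monoʳ-neg {c} c<0 (inj₁ p)       = inj₁ (QP.*-monoʳ-<-neg c {{Q.negative c<0}} p)
  monoʳ-neg {c} c<0 (inj₂ (e , p)) = inj₂ (cong (c *_) (sym e) , QP.*-monoʳ-<-neg c {{Q.negative c<0}} p)
  zeros : ∀ c d → c * 0ℚ ≡ d * 0ℚ
  zeros c d = trans (QP.*-zeroʳ c) (sym (QP.*-zeroʳ d))
  monoˡ-pos : ∀ {c d a} → (0ℚ ·⋆ ι 1ℚ) <⋆ a → c Q.< d → (c ·⋆ a) <⋆ (d ·⋆ a)
  monoˡ-pos {c} {d} {x + y ε} (inj₁ 0<x) c<d = inj₁ (QP.*-monoˡ-<-pos x {{Q.positive 0<x}} c<d)
  monoˡ-pos {c} {d} {x + y ε} (inj₂ (refl , 0<y)) c<d = inj₂ (zeros c d , QP.*-monoˡ-<-pos y {{Q.positive 0<y}} c<d)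
  monoˡ-neg : ∀ {c d a} → a <⋆ (0ℚ ·⋆ ι 1ℚ) → c Q.< d → (d ·⋆ a) <⋆ (c ·⋆ a)
  monoˡ-neg {c} {d} {x + y ε} (inj₁ x<0) c<d = inj₁ (QP.*-monoˡ-<-neg x {{Q.negative x<0}} c<d)
  monoˡ-neg {c} {d} {x + y ε} (inj₂ (refl , y<0)) c<d = inj₂ (zeros d c , QP.*-monoˡ-<-neg y {{Q.negative y<0}} c<d)

cmpℚ : ℚ → ℚ → Ordering
cmpℚ = Compare.cmp QP.<-isStrictTotalOrder

-- 1/c, with the junk value 0 at c = 0
inv : ℚ → ℚ
inv c with c Q.≟ 0ℚ
... | yes _   = 0ℚ
... | no c≢0 = Q.1/_ c {{Q.≢-nonZero c≢0}}

*-inv-cancelˡ : ∀ {c} k → c ≢ 0ℚ → c * (inv c * k) ≡ k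
*-inv-cancelˡ {c} k c≢0 with c Q.≟ 0ℚ
... | yes c≡0 = contradiction c≡0 c≢0
... | no c≢0′ = begin
  c * (Q.1/_ c {{Q.≢-nonZero c≢0′}} * k) ≡⟨ QP.*-assoc c _ k ⟨
  c * Q.1/_ c {{Q.≢-nonZero c≢0′}} * k   ≡⟨ cong (_* k) (QP.*-inverseʳ c {{Q.≢-nonZero c≢0′}}) ⟩
  1ℚ * k                                  ≡⟨ QP.*-identityˡ k ⟩
  k                                       ∎
  where open ≡-Reasoning

coefficient : {W : Set} → Term₀ W → ℚ
coefficient (var _)    = 1ℚ
coefficient one        = 1ℚ
coefficient (smul c t) = c * coefficient t

-- the variable a term scales, nothing standing for the constant 𝟙
base : {W : Set} → Term₀ W → Maybe W
base (var v)    = just v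
base one        = nothing
base (smul _ t) = base t

coefficients : {W : Set} → QF₀ W → List ℚ
coefficients tt       = []
coefficients ff       = []
coefficients (t ≐₀ u) = coefficient t ∷ coefficient u ∷ []
coefficients (t ⋖₀ u) = coefficient t ∷ coefficient u ∷ []
coefficients (¬₀ ψ)   = coefficients ψ
coefficients (ψ ∧₀ χ) = coefficients ψ ++ coefficients χ
coefficients (ψ ∨₀ χ) = coefficients ψ ++ coefficients χ

module OrderedℚSpace {M : τ₀-Structure} (isM : IsOrderedℚSpace M) where
  open τ₀-Structure M public renaming (Carrier to D)
  open IsOrderedℚSpace isM public renaming (trans to <-trans)
  open Compare isStrictTotalOrder public
  private
    module ℚM = Compare₂ QP.<-isStrictTotalOrder isStrictTotalOrder
    module MM = Compare₂ isStrictTotalOrder isStrictTotalOrder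

  𝟘 : D
  𝟘 = 0ℚ · 𝟙

  ·-𝟘 : ∀ c d → (c · 𝟘) ≡ (d · 𝟘)
  ·-𝟘 c d = begin
    c · (0ℚ · 𝟙)   ≡⟨ ·-assoc c 0ℚ 𝟙 ⟩
    (c * 0ℚ) · 𝟙   ≡⟨ cong (_· 𝟙) (trans (QP.*-zeroʳ c) (sym (QP.*-zeroʳ d))) ⟩
    (d * 0ℚ) · 𝟙   ≡⟨ ·-assoc d 0ℚ 𝟙 ⟨
    d · (0ℚ · 𝟙)   ∎
    where open ≡-Reasoning

  cmp-𝟙 : cmp 𝟙 𝟘 ≡ gt
  cmp-𝟙 = cmp-> 0<𝟙

  cmp-·-scale : ∀ {c} → c ≢ 0ℚ → ∀ a b → cmp (c · a) (c · b) ≡ cmpℚ c 0ℚ ⊗ cmp a b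
  cmp-·-scale {c} c≢0 a b with QP.<-cmp c 0ℚ
  ... | tri< c<0 _ _ = MM.cmp-anti (c ·_) (·-monoʳ-<-neg c<0) a b
  ... | tri≈ _ c≡0 _ = contradiction c≡0 c≢0
  ... | tri> _ _ 0<c = MM.cmp-mono (c ·_) (·-monoʳ-<-pos 0<c) a b

  cmp-·-cancel : ∀ {c} k → c ≢ 0ℚ → ∀ a b → cmp (c · a) (k · b) ≡ cmpℚ c 0ℚ ⊗ cmp a ((inv c * k) · b)
  cmp-·-cancel {c} k c≢0 a b = begin
    cmp (c · a) (k · b)                         ≡⟨ cong (cmp (c · a)) unscale ⟨
    cmp (c · a) (c · ((inv c * k) · b))          ≡⟨ cmp-·-scale c≢0 a _ ⟩
    cmpℚ c 0ℚ ⊗ cmp a ((inv c * k) · b)         ∎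
    where
    open ≡-Reasoning
    unscale : (c · ((inv c * k) · b)) ≡ (k · b)
    unscale = trans (·-assoc c (inv c * k) b) (cong (_· b) (*-inv-cancelˡ k c≢0))

  cmp-·-self : ∀ c d a → cmp (c · a) (d · a) ≡ cmp a 𝟘 ⊗ cmpℚ c d
  cmp-·-self c d a with compare a 𝟘
  ... | tri< a<0 _ _ = ℚM.cmp-anti (_· a) (·-monoˡ-<-neg a<0) c d
  ... | tri≈ _ refl _ = cmp-≡ (·-𝟘 c d)
  ... | tri> _ _ 0<a = ℚM.cmp-mono (_· a) (·-monoˡ-<-pos 0<a) c d

  value : {V : Set} → (V → D) → Maybe V → D
  value s = maybe′ s 𝟙

  evalT-normal : {V W : Set} (s : V → D) (ρ : W → V) (t : Term₀ W) →
                 evalT M (s ∘ ρ) t ≡ (coefficient t · value s (Maybe.map ρ (base t)))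
  evalT-normal s ρ (var v)    = sym (·-identityˡ (s (ρ v)))
  evalT-normal s ρ one        = sym (·-identityˡ 𝟙)
  evalT-normal s ρ (smul c t) = trans (cong (c ·_) (evalT-normal s ρ t)) (·-assoc c (coefficient t) _)

  scaled : (ℕ → D) → ℚ × Maybe ℕ → D
  scaled s (c , p) = c · value s p

-- Back-and-forth systems

update-≡ : {D : Set} (s : ℕ → D) (x : ℕ) (d : D) → update s x d x ≡ d
update-≡ s x d with x ℕ.≟ x
... | yes _   = refl
... | no x≢x = contradiction refl x≢x

update-self : {D : Set} (s : ℕ → D) (v y : ℕ) → update s v (s v) y ≡ s y
update-self s v y with v ℕ.≟ y
... | yes refl = refl
... | no _     = refl

variables : {σ : Signature} → Formula σ → List ℕ
variables {σ} (R i xs) = map xs (allFin (arity σ i))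
variables (x ≐ y)      = x ∷ y ∷ []
variables ⊥'           = []
variables (¬' φ)       = variables φ
variables (φ ∧' ψ)     = variables φ ++ variables ψ
variables (φ ∨' ψ)     = variables φ ++ variables ψ
variables (∃' x φ)     = x ∷ variables φ
variables (∀' x φ)     = x ∷ variables φ

quantifierDepth : {σ : Signature} → Formula σ → ℕ
quantifierDepth (R _ _)  = 0
quantifierDepth (_ ≐ _)  = 0
quantifierDepth ⊥'       = 0
quantifierDepth (¬' φ)   = quantifierDepth φ
quantifierDepth (φ ∧' ψ) = quantifierDepth φ ⊔ quantifierDepth ψ
quantifierDepth (φ ∨' ψ) = quantifierDepth φ ⊔ quantifierDepth ψ
quantifierDepth (∃' _ φ) = suc (quantifierDepth φ)
quantifierDepth (∀' _ φ) = suc (quantifierDepth φ)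

record BackAndForth {σ : Signature} {A B : Set} (𝔄 : Structure σ A) (𝔅 : Structure σ B) : Set₁ where
  field
    Related       : ℕ → List ℕ → (ℕ → A) → (ℕ → B) → Set
    related-rel   : ∀ {k V s t} → Related k V s t → ∀ i (xs : Fin (arity σ i) → ℕ) → (∀ j → xs j ∈ V) →
                    rel 𝔄 i (s ∘ xs) ⇔ rel 𝔅 i (t ∘ xs)
    related-≡     : ∀ {k V s t x y} → Related k V s t → x ∈ V → y ∈ V → (s x ≡ s y) ⇔ (t x ≡ t y)
    forth         : ∀ {k V s t} → Related (suc k) V s t →
                    ∀ x a → ∃[ b ] Related k (x ∷ V) (update s x a) (update t x b)
    back          : ∀ {k V s t} → Related (suc k) V s t →
                    ∀ x b → ∃[ a ] Related k (x ∷ V) (update s x a) (update t x b)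
    related-[]    : ∀ k s → ∃[ t ] Related k [] s t
    related-respˡ : ∀ {k V s s′ t} → (∀ y → s y ≡ s′ y) → Related k V s t → Related k V s′ t

  Sat-⇔ : ∀ {k V s t} φ → Related k V s t → quantifierDepth φ ≤ k → variables φ ⊆ V →
          Sat 𝔄 s φ ⇔ Sat 𝔅 t φ
  Sat-⇔ (R i xs) r _ vs = related-rel r i xs (λ j → vs (∈-map⁺ xs (∈-allFin j)))
  Sat-⇔ (x ≐ y)  r _ vs = related-≡ r (vs (here refl)) (vs (there (here refl)))
  Sat-⇔ ⊥'       _ _ _  = ⇔-id _
  Sat-⇔ (¬' φ)   r d vs = ¬-cong-⇔ (Sat-⇔ φ r d vs)
  Sat-⇔ (φ ∧' ψ) r d vs =
    Sat-⇔ φ r (m⊔n≤o⇒m≤o _ _ d) (vs ∘ ∈-++⁺ˡ) ×-⇔ Sat-⇔ ψ r (m⊔n≤o⇒n≤o _ _ d) (vs ∘ ∈-++⁺ʳ _)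
  Sat-⇔ (φ ∨' ψ) r d vs =
    Sat-⇔ φ r (m⊔n≤o⇒m≤o _ _ d) (vs ∘ ∈-++⁺ˡ) ⊎-⇔ Sat-⇔ ψ r (m⊔n≤o⇒n≤o _ _ d) (vs ∘ ∈-++⁺ʳ _)
  Sat-⇔ (∃' x φ) r (s≤s d) vs = mk⇔
    (λ (a , sat) → let b , r′ = forth r x a in b , Equivalence.to (Sat-⇔ φ r′ d (there ∘ vs ∘ there)) sat)
    (λ (b , sat) → let a , r′ = back r x b in a , Equivalence.from (Sat-⇔ φ r′ d (there ∘ vs ∘ there)) sat)
  Sat-⇔ (∀' x φ) r (s≤s d) vs = mk⇔
    (λ sat b → let a , r′ = back r x b in Equivalence.to (Sat-⇔ φ r′ d (there ∘ vs ∘ there)) (sat a))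
    (λ sat a → let b , r′ = forth r x a in Equivalence.from (Sat-⇔ φ r′ d (there ∘ vs ∘ there)) (sat b))

  related-exists : ∀ V k s → ∃[ t ] Related k V s t
  related-exists [] k s = related-[] k s
  related-exists (v ∷ V) k s =
    let t , r = related-exists V (suc k) s
        b , r′ = forth r v (s v)
    in update t v b , related-respˡ (update-self s v) r′

  satisfiable-transfer : ∀ φ → Satisfiable 𝔄 φ → Satisfiable 𝔅 φ
  satisfiable-transfer φ (s , sat) =
    let t , r = related-exists (variables φ) (quantifierDepth φ) s
    in t , Equivalence.to (Sat-⇔ φ r ≤-refl (λ x∈ → x∈)) sat

Sat-cong : {σ : Signature} {A : Set} {𝔄 𝔅 : Structure σ A} → (∀ i x → rel 𝔄 i x ⇔ rel 𝔅 i x) →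
           ∀ φ s → Sat 𝔄 s φ ⇔ Sat 𝔅 s φ
Sat-cong rel⇔ (R i xs) s = rel⇔ i _
Sat-cong rel⇔ (x ≐ y)  s = ⇔-id _
Sat-cong rel⇔ ⊥'       s = ⇔-id _
Sat-cong rel⇔ (¬' φ)   s = ¬-cong-⇔ (Sat-cong rel⇔ φ s)
Sat-cong rel⇔ (φ ∧' ψ) s = Sat-cong rel⇔ φ s ×-⇔ Sat-cong rel⇔ ψ s
Sat-cong rel⇔ (φ ∨' ψ) s = Sat-cong rel⇔ φ s ⊎-⇔ Sat-cong rel⇔ ψ s
Sat-cong rel⇔ (∃' x φ) s = mk⇔ (λ (a , sat) → a , Equivalence.to (Sat-cong rel⇔ φ _) sat)
                                (λ (a , sat) → a , Equivalence.from (Sat-cong rel⇔ φ _) sat)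
Sat-cong rel⇔ (∀' x φ) s = mk⇔ (λ sat a → Equivalence.to (Sat-cong rel⇔ φ _) (sat a))
                                (λ sat a → Equivalence.from (Sat-cong rel⇔ φ _) (sat a))

Satisfiable-cong : {σ : Signature} {A : Set} {𝔄 𝔅 : Structure σ A} → (∀ i x → rel 𝔄 i x ⇔ rel 𝔅 i x) →
                   ∀ φ → Satisfiable 𝔄 φ ⇔ Satisfiable 𝔅 φ
Satisfiable-cong rel⇔ φ = mk⇔ (λ (s , sat) → s , Equivalence.to (Sat-cong rel⇔ φ s) sat)
                              (λ (s , sat) → s , Equivalence.from (Sat-cong rel⇔ φ s) sat)

DefinedIn : {σ : Signature} (M : τ₀-Structure) → QFDefs σ → Structure σ (τ₀-Structure.Carrier M)
DefinedIn M φs = record { rel = λ i x → evalQF M x (φs i) }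

-- Agreement of assignments into two ordered ℚ-spaces

points : List ℕ → List (Maybe ℕ)
points V = nothing ∷ map just V


map-∈-points : ∀ {W : Set} {V} {ρ : W → ℕ} → (∀ w → ρ w ∈ V) → ∀ p → Maybe.map ρ p ∈ points V
map-∈-points ρ∈ nothing  = here refl
map-∈-points ρ∈ (just w) = there (∈-map⁺ just (ρ∈ w))

×-⊆ˡ : {A B : Set} {T T′ : List A} {P : List B} → T ⊆ T′ → cartesianProduct T P ⊆ cartesianProduct T′ P
×-⊆ˡ {T = T} {P = P} T⊆T′ cp∈ = let c∈ , p∈ = ∈-cartesianProduct⁻ T P cp∈ in ∈-cartesianProduct⁺ (T⊆T′ c∈) p∈

data Position (x : ℕ) (V : List ℕ) : Maybe ℕ → Set where
  new : Position x V (just x)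
  old : ∀ {p} → p ∈ points V → p ≢ just x → Position x V p

position : ∀ {x V p} → p ∈ points (x ∷ V) → Position x V p
position (here refl) = old (here refl) λ ()
position (there (here refl)) = new
position {x} (there (there p∈)) with ∈-map⁻ just p∈
... | v , v∈ , refl with v ℕ.≟ x
...   | yes refl = new
...   | no v≢x = old (there (∈-map⁺ just v∈)) λ { refl → v≢x refl }

module _ {D : Set} (u : D) where
  update-≢ : ∀ (s : ℕ → D) x d {p} → p ≢ just x → maybe′ (update s x d) u p ≡ maybe′ s u p
  update-≢ s x d {nothing} _ = refl
  update-≢ s x d {just y} p≢x with x ℕ.≟ y
  ... | yes refl = contradiction refl p≢x
  ... | no _     = refl

  maybe′-cong : ∀ {s s′ : ℕ → D} → (∀ y → s y ≡ s′ y) → ∀ p → maybe′ s u p ≡ maybe′ s′ u p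
  maybe′-cong s≗s′ nothing  = refl
  maybe′-cong s≗s′ (just y) = s≗s′ y

ratios : List ℚ → List ℚ
ratios T = cartesianProductWith (λ c k → inv c * k) T T

expand : List ℚ → List ℚ
expand T = T ++ 0ℚ ∷ ratios T

⊆-expand : ∀ T → T ⊆ expand T
⊆-expand T = ∈-++⁺ˡ {ys = 0ℚ ∷ ratios T}

ratios-⊆-expand : ∀ T → 0ℚ ∷ ratios T ⊆ expand T
ratios-⊆-expand T = ∈-++⁺ʳ T

module Agreement {M N : τ₀-Structure} (isM : IsOrderedℚSpace M) (isN : IsOrderedℚSpace N) where
  private
    module A = OrderedℚSpace isM
    module B = OrderedℚSpace isN
  open Compare₂ A.isStrictTotalOrder B.isStrictTotalOrder using (SameOrder; SameOrder-⊆; cmp-≡⇒≡⇔; cmp-≡⇒<⇔)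

  record Agree (T : List ℚ) (V : List ℕ) (s : ℕ → A.D) (t : ℕ → B.D) : Set where
    constructor agreeing
    field same-order : SameOrder (A.scaled s) (B.scaled t) (cartesianProduct T (points V))

  agree-⊆ : ∀ {T T′ V s t} → T ⊆ T′ → Agree T′ V s t → Agree T V s t
  agree-⊆ T⊆T′ (agreeing same) = agreeing (SameOrder-⊆ (×-⊆ˡ T⊆T′) same)

  agree-[] : ∀ {T s t} → Agree T [] s t
  agree-[] {T} {s} {t} = agreeing same
    where
    open ≡-Reasoning
    same : SameOrder (A.scaled s) (B.scaled t) (cartesianProduct T (points []))
    same {c , _} {k , _} i∈ j∈
      with _ , here refl ← ∈-cartesianProduct⁻ T _ i∈
         | _ , here refl ← ∈-cartesianProduct⁻ T _ j∈ = begin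
      A.cmp (c A.· A.𝟙) (k A.· A.𝟙)   ≡⟨ A.cmp-·-self c k A.𝟙 ⟩
      A.cmp A.𝟙 A.𝟘 ⊗ cmpℚ c k         ≡⟨ cong (_⊗ cmpℚ c k) (trans A.cmp-𝟙 (sym B.cmp-𝟙)) ⟩
      B.cmp B.𝟙 B.𝟘 ⊗ cmpℚ c k         ≡⟨ B.cmp-·-self c k B.𝟙 ⟨
      B.cmp (c B.· B.𝟙) (k B.· B.𝟙)   ∎

  agree-respˡ : ∀ {T V s s′ t} → (∀ y → s y ≡ s′ y) → Agree T V s t → Agree T V s′ t
  agree-respˡ {T} {V} {s} {s′} {t} s≗s′ (agreeing same) = agreeing same′
    where
    same′ : SameOrder (A.scaled s′) (B.scaled t) (cartesianProduct T (points V))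
    same′ {_ , p} {_ , q} i∈ j∈
      rewrite sym (maybe′-cong A.𝟙 s≗s′ p) | sym (maybe′-cong A.𝟙 s≗s′ q) = same i∈ j∈

  module _ {T V s t} (agree : Agree T V s t) {d e}
           (placed : ∀ {i} → i ∈ cartesianProduct (0ℚ ∷ ratios T) (points V) →
                     B.cmp e (B.scaled t i) ≡ A.cmp d (A.scaled s i)) where
    private
      at : ∀ {c k p q} → c ∈ T → k ∈ T → p ∈ points V → q ∈ points V →
           A.cmp (c A.· A.value s p) (k A.· A.value s q) ≡ B.cmp (c B.· B.value t p) (k B.· B.value t q)
      at c∈ k∈ p∈ q∈ = Agree.same-order agree (∈-cartesianProduct⁺ c∈ p∈) (∈-cartesianProduct⁺ k∈ q∈)

    agree-new-old : ∀ {c k q} → c ∈ T → k ∈ T → q ∈ points V →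
                    A.cmp (c A.· d) (k A.· A.value s q) ≡ B.cmp (c B.· e) (k B.· B.value t q)
    agree-new-old {c} {k} {q} c∈ k∈ q∈ with c Q.≟ 0ℚ
    ... | yes refl = begin
      A.cmp (0ℚ A.· d) (k A.· A.value s q)    ≡⟨ cong (λ a → A.cmp a (k A.· A.value s q)) (A.·-zeroˡ d) ⟩
      A.cmp A.𝟘 (k A.· A.value s q)           ≡⟨ at c∈ k∈ (here refl) q∈ ⟩
      B.cmp B.𝟘 (k B.· B.value t q)           ≡⟨ cong (λ b → B.cmp b (k B.· B.value t q)) (B.·-zeroˡ e) ⟨
      B.cmp (0ℚ B.· e) (k B.· B.value t q)    ∎
      where open ≡-Reasoning
    ... | no c≢0 = begin
      A.cmp (c A.· d) (k A.· A.value s q)                 ≡⟨ A.cmp-·-cancel k c≢0 d _ ⟩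
      cmpℚ c 0ℚ ⊗ A.cmp d ((inv c * k) A.· A.value s q)    ≡⟨ cong (cmpℚ c 0ℚ ⊗_) (placed ratio∈) ⟨
      cmpℚ c 0ℚ ⊗ B.cmp e ((inv c * k) B.· B.value t q)    ≡⟨ B.cmp-·-cancel k c≢0 e _ ⟨
      B.cmp (c B.· e) (k B.· B.value t q)                 ∎
      where
      open ≡-Reasoning
      ratio∈ : (inv c * k , q) ∈ cartesianProduct (0ℚ ∷ ratios T) (points V)
      ratio∈ = ∈-cartesianProduct⁺ (there (∈-cartesianProductWith⁺ (λ c k → inv c * k) c∈ k∈)) q∈

    agree-new-new : ∀ c k → A.cmp (c A.· d) (k A.· d) ≡ B.cmp (c B.· e) (k B.· e)
    agree-new-new c k = begin
      A.cmp (c A.· d) (k A.· d)   ≡⟨ A.cmp-·-self c k d ⟩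
      A.cmp d A.𝟘 ⊗ cmpℚ c k      ≡⟨ cong (_⊗ cmpℚ c k) (placed zero∈) ⟨
      B.cmp e B.𝟘 ⊗ cmpℚ c k      ≡⟨ B.cmp-·-self c k e ⟨
      B.cmp (c B.· e) (k B.· e)   ∎
      where
      open ≡-Reasoning
      zero∈ : (0ℚ , nothing) ∈ cartesianProduct (0ℚ ∷ ratios T) (points V)
      zero∈ = ∈-cartesianProduct⁺ {xs = 0ℚ ∷ ratios T} {ys = points V} (here refl) (here refl)

    agree-update : ∀ x → Agree T (x ∷ V) (update s x d) (update t x e)
    agree-update x = agreeing same
      where
      same : SameOrder (A.scaled (update s x d)) (B.scaled (update t x e)) (cartesianProduct T (points (x ∷ V)))
      same {c , p} {k , q} i∈ j∈
        with c∈ , p∈ ← ∈-cartesianProduct⁻ T _ i∈ | k∈ , q∈ ← ∈-cartesianProduct⁻ T _ j∈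
        with position p∈ | position q∈
      ... | new | new rewrite update-≡ s x d | update-≡ t x e = agree-new-new c k
      ... | new | old q∈′ q≢x
        rewrite update-≡ s x d | update-≡ t x e | update-≢ A.𝟙 s x d q≢x | update-≢ B.𝟙 t x e q≢x
        = agree-new-old c∈ k∈ q∈′
      ... | old p∈′ p≢x | new
        rewrite update-≡ s x d | update-≡ t x e | update-≢ A.𝟙 s x d p≢x | update-≢ B.𝟙 t x e p≢x
        = trans (A.cmp-sym (k A.· d) (c A.· A.value s p))
            (trans (cong opposite (agree-new-old k∈ c∈ p∈′)) (sym (B.cmp-sym (k B.· e) (c B.· B.value t p))))
      ... | old p∈′ p≢x | old q∈′ q≢x
        rewrite update-≢ A.𝟙 s x d p≢x | update-≢ B.𝟙 t x e p≢x | update-≢ A.𝟙 s x d q≢x | update-≢ B.𝟙 t x e q≢x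
        = at c∈ k∈ p∈′ q∈′

  agree-forth : ∀ {T V s t} → Agree (expand T) V s t →
                ∀ x d → ∃[ e ] Agree T (x ∷ V) (update s x d) (update t x e)
  agree-forth {T} agree x d =
    let e , placed = fill-cut A.isStrictTotalOrder B.isUnboundedDenseLinearOrder B.𝟙
                       (Agree.same-order (agree-⊆ (ratios-⊆-expand T) agree)) d
    in e , agree-update (agree-⊆ (⊆-expand T) agree) placed x

  agree-terms : ∀ {T V s t} {W : Set} → Agree T V s t → (ρ : W → ℕ) (u w : Term₀ W) →
                (coefficient u , Maybe.map ρ (base u)) ∈ cartesianProduct T (points V) →
                (coefficient w , Maybe.map ρ (base w)) ∈ cartesianProduct T (points V) →
                A.cmp (evalT M (s ∘ ρ) u) (evalT M (s ∘ ρ) w) ≡ B.cmp (evalT N (t ∘ ρ) u) (evalT N (t ∘ ρ) w)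
  agree-terms {s = s} {t} (agreeing same) ρ u w u∈ w∈
    rewrite A.evalT-normal s ρ u | A.evalT-normal s ρ w | B.evalT-normal t ρ u | B.evalT-normal t ρ w
    = same u∈ w∈

  agree-evalQF : ∀ {T V s t} {W : Set} → Agree T V s t → (ρ : W → ℕ) → (∀ w → ρ w ∈ V) →
                 (ψ : QF₀ W) → coefficients ψ ⊆ T → evalQF M (s ∘ ρ) ψ ⇔ evalQF N (t ∘ ρ) ψ
  agree-evalQF agree ρ ρ∈ tt       _  = ⇔-id _
  agree-evalQF agree ρ ρ∈ ff       _  = ⇔-id _
  agree-evalQF agree ρ ρ∈ (u ≐₀ w) cs = cmp-≡⇒≡⇔ (agree-terms agree ρ u w
    (∈-cartesianProduct⁺ (cs (here refl)) (map-∈-points ρ∈ (base u)))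
    (∈-cartesianProduct⁺ (cs (there (here refl))) (map-∈-points ρ∈ (base w))))
  agree-evalQF agree ρ ρ∈ (u ⋖₀ w) cs = cmp-≡⇒<⇔ (agree-terms agree ρ u w
    (∈-cartesianProduct⁺ (cs (here refl)) (map-∈-points ρ∈ (base u)))
    (∈-cartesianProduct⁺ (cs (there (here refl))) (map-∈-points ρ∈ (base w))))
  agree-evalQF agree ρ ρ∈ (¬₀ ψ)   cs = ¬-cong-⇔ (agree-evalQF agree ρ ρ∈ ψ cs)
  agree-evalQF agree ρ ρ∈ (ψ ∧₀ χ) cs =
    agree-evalQF agree ρ ρ∈ ψ (cs ∘ ∈-++⁺ˡ) ×-⇔ agree-evalQF agree ρ ρ∈ χ (cs ∘ ∈-++⁺ʳ _)
  agree-evalQF agree ρ ρ∈ (ψ ∨₀ χ) cs =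
    agree-evalQF agree ρ ρ∈ ψ (cs ∘ ∈-++⁺ˡ) ⊎-⇔ agree-evalQF agree ρ ρ∈ χ (cs ∘ ∈-++⁺ʳ _)

level : List ℚ → ℕ → List ℚ
level T zero    = T
level T (suc n) = expand (level T n)

⊆-level : ∀ T n → T ⊆ level T n
⊆-level T zero    = id
⊆-level T (suc n) = ⊆-expand (level T n) ∘ ⊆-level T n

agree-sym : ∀ {M N} (isM : IsOrderedℚSpace M) (isN : IsOrderedℚSpace N) {T V s t} →
            Agreement.Agree isM isN T V s t → Agreement.Agree isN isM T V t s
agree-sym isM isN (Agreement.agreeing same) = Agreement.agreeing λ i∈ j∈ → sym (same i∈ j∈)

module _ {σ : Signature} {M N : τ₀-Structure} (isM : IsOrderedℚSpace M) (isN : IsOrderedℚSpace N)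
         (φs : QFDefs σ) (T : List ℚ) (1∈T : 1ℚ ∈ T) (φs⊆T : ∀ i → coefficients (φs i) ⊆ T) where
  open Agreement isM isN
  private
    module A = OrderedℚSpace isM
    module B = OrderedℚSpace isN

  open Compare₂ A.isStrictTotalOrder B.isStrictTotalOrder using (cmp-≡⇒≡⇔)

  var∈ : ∀ {V} k {x} → x ∈ V → (1ℚ , just x) ∈ cartesianProduct (level T k) (points V)
  var∈ k x∈ = ∈-cartesianProduct⁺ (⊆-level T k 1∈T) (there (∈-map⁺ just x∈))

  agreement-backAndForth : BackAndForth (DefinedIn M φs) (DefinedIn N φs)
  agreement-backAndForth = record
    { Related       = λ k → Agree (level T k)
    ; related-rel   = λ {k} agree i xs xs∈ → agree-evalQF agree xs xs∈ (φs i) (⊆-level T k ∘ φs⊆T i)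
    ; related-≡     = λ {k} agree x∈ y∈ → cmp-≡⇒≡⇔ (agree-terms agree id (var _) (var _) (var∈ k x∈) (var∈ k y∈))
    ; forth         = λ agree → agree-forth agree
    ; back          = λ agree x b → let a , agree′ = Agreement.agree-forth isN isM (agree-sym isM isN agree) x b
                                    in a , agree-sym isN isM agree′
    ; related-[]    = λ _ _ → (λ _ → B.𝟙) , agree-[]
    ; related-respˡ = agree-respˡ
    }

allCoefficients : {σ : Signature} → QFDefs σ → List ℚ
allCoefficients {σ} φs = concat (map (coefficients ∘ φs) (allFin (size σ)))

coefficients-⊆ : {σ : Signature} (φs : QFDefs σ) → ∀ i → coefficients (φs i) ⊆ allCoefficients φs
coefficients-⊆ φs i c∈ = ∈-concat⁺′ c∈ (∈-map⁺ (coefficients ∘ φs) (∈-allFin i))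

DefinedIn-satisfiable : ∀ {σ M N} → IsOrderedℚSpace M → IsOrderedℚSpace N → (φs : QFDefs σ) →
                        ∀ φ → Satisfiable (DefinedIn M φs) φ → Satisfiable (DefinedIn N φs) φ
DefinedIn-satisfiable isM isN φs = BackAndForth.satisfiable-transfer
  (agreement-backAndForth isM isN φs (1ℚ ∷ allCoefficients φs) (here refl) (λ i → there ∘ coefficients-⊆ φs i))

corollary4p5 : (σ : Signature) (𝔄 : Structure σ ℚ) (φs : QFDefs σ) →
    Defines 𝔄 φs → (φ : Formula σ) →
    Satisfiable 𝔄 φ ⇔ Satisfiable (Star φs) φ
corollary4p5 σ 𝔄 φs defines φ =
  mk⇔ (DefinedIn-satisfiable 𝔏-isOrderedℚSpace 𝔏⋆-isOrderedℚSpace φs φ)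
      (DefinedIn-satisfiable 𝔏⋆-isOrderedℚSpace 𝔏-isOrderedℚSpace φs φ)
  ⇔-∘ Satisfiable-cong defines φ
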